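{- For every $n\ge1$, the Wiener indices of the polyphenyl ortho-chain $\overline{O}_n$, the polyphenyl meta-chain $\overline{M}_n$ and the polyphenyl para-chain $\overline{P}_n$ are $$W(\overline{O}_n)=12n^3+36n^2-21n,\quad W(\overline{M}_n)=18n^3+18n^2-9n,\quad W(\overline{P}_n)=24n^3+3n.$$
   Context: The Wiener index is $W(G)=\sum_{\{u,v\}\subseteq V(G)} d(u,v)$, with $d$ the shortest-path distance. A polyphenyl hexagonal chain with $n$ hexagons is a graph consisting of pairwise vertex-disjoint hexagons (6-cycles) $\overline{H}_0,\dots,\overline{H}_{n-1}$ together with, for each $1\le k\le n-1$, one cut-edge joining a vertex $c_k$ of $\overline{H}_k$ to a vertex $t_k$ of $\overline{H}_{k-1}$, where $t_k\ne c_{k-1}$ for $k\ge2$. The polyphenyl ortho-chain $\overline{O}_n$ (resp. meta-chain $\overline{M}_n$, para-chain $\overline{P}_n$) is the one with $d(c_{k-1},t_k)=1$ (resp. $2$, resp. $3$) for all $2\le k\le n-1$. -}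

module Defs where

open import Data.Nat using (ℕ; zero; suc; _+_; _*_; _∸_; _^_; _≤_; _<_; _⊓_; ∣_-_∣)
open import Data.Fin using (Fin; toℕ) renaming (zero to f0; suc to fs)
open import Data.List using (List; []; _∷_; map; _++_; allFin; cartesianProduct)
open import Data.Nat.ListAction using (sum)
open import Data.Product using (Σ; _×_; _,_; proj₁; proj₂)
open import Data.Sum using (_⊎_)
open import Relation.Binary.PropositionalEquality using (_≡_)

-- Vertices of a polyphenyl hexagonal chain with n hexagons:
-- (k , i) is the vertex at cyclic position i of hexagon H̄_k.
V : ℕ → Set
V n = Fin n × Fin 6

next : Fin 6 → Fin 6
next f0 = fs f0
next (fs f0) = fs (fs f0)
next (fs (fs f0)) = fs (fs (fs f0))
next (fs (fs (fs f0))) = fs (fs (fs (fs f0)))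
next (fs (fs (fs (fs f0)))) = fs (fs (fs (fs (fs f0))))
next (fs (fs (fs (fs (fs f0))))) = f0

hexDist : Fin 6 → Fin 6 → ℕ
hexDist i j = ∣ toℕ i - toℕ j ∣ ⊓ (6 ∸ ∣ toℕ i - toℕ j ∣)

-- The chain is determined by c, t : ℕ → Fin 6 : for 1 ≤ k ≤ n-1 the cut-edge
-- joins (k , c k) in H̄_k with (k-1 , t k) in H̄_{k-1}.  (c 0 and t 0 unused.)
Adj : (n : ℕ) → (c t : ℕ → Fin 6) → V n → V n → Set
Adj n c t (k , i) (l , j) =
  (k ≡ l × (j ≡ next i ⊎ i ≡ next j))
  ⊎ (toℕ k ≡ suc (toℕ l) × i ≡ c (toℕ k) × j ≡ t (toℕ k))
  ⊎ (toℕ l ≡ suc (toℕ k) × j ≡ c (toℕ l) × i ≡ t (toℕ l))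

data Walk (n : ℕ) (c t : ℕ → Fin 6) : V n → V n → ℕ → Set where
  here : ∀ {u} → Walk n c t u u 0
  step : ∀ {u w v m} → Adj n c t u w → Walk n c t w v m → Walk n c t u v (suc m)

IsShortestPathDist : (n : ℕ) → (c t : ℕ → Fin 6) → (V n → V n → ℕ) → Set
IsShortestPathDist n c t d =
  ∀ u v → Walk n c t u v (d u v) × (∀ m → Walk n c t u v m → d u v ≤ m)

pairs : {A : Set} → List A → List (A × A)
pairs [] = []
pairs (x ∷ xs) = map (x ,_) xs ++ pairs xs

allV : (n : ℕ) → List (V n)
allV n = cartesianProduct (allFin n) (allFin 6)

Wiener : (n : ℕ) → (V n → V n → ℕ) → ℕ
Wiener n d = sum (map (λ p → d (proj₁ p) (proj₂ p)) (pairs (allV n)))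

-- the chain has d(c_{k-1}, t_k) = δ for all 2 ≤ k ≤ n-1
-- (δ = 1 ortho, δ = 2 meta, δ = 3 para; δ ≥ 1 forces t_k ≠ c_{k-1})
IsChainType : ℕ → ℕ → (c t : ℕ → Fin 6) → Set
IsChainType n δ c t = ∀ k → 2 ≤ k → k < n → hexDist (c (k ∸ 1)) (t k) ≡ δ

HasWiener : (n : ℕ) → (c t : ℕ → Fin 6) → ℕ → Set
HasWiener n c t w = Σ (V n → V n → ℕ) λ d → IsShortestPathDist n c t d × Wiener n d ≡ w

-- A polyphenyl chain is a tree of hexagons, so the distance between a
-- vertex i of hexagon k and a vertex j of a later hexagon l is forced: walk
-- inside hexagon k to the attachment vertex t(k+1), cross the cut-edge to
-- c(k+1), and so on up to hexagon l.  We write this length down explicitly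
-- ('Chain.dist') and show it is the shortest-path distance: it is realised
-- by a walk, and it changes by at most one along every edge, so it is a
-- lower bound for the length of every walk.
--
-- The Wiener index is then computed by peeling off the first hexagon: the
-- pairs inside it contribute 27, and every path from it to a later vertex
-- leaves through the cut-edge, which expresses the remaining cross terms by
-- the transmission of the attachment vertex c(1).  When every gap
-- d(c_{k-1}, t_k) equals δ this gives closed forms for the transmission and
-- for the Wiener index, valid for every δ; the theorem is the case δ = 1, 2, 3.

module Submission where

open import Defs
open import Data.Nat using (ℕ; _+_; _*_; _∸_; _^_; _≤_)
open import Data.Fin using (Fin)
open import Data.Product using (_×_)

open import Data.Nat using (zero; suc; _<_; z≤n; s≤s; _≤?_; _≟_)
open import Data.Nat.Properties
open import Data.Fin using (toℕ; fromℕ<) renaming (zero to fzero; suc to fsuc)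
open import Data.Fin.Properties using (toℕ-injective; toℕ<n; toℕ-fromℕ<; all?)
  renaming (_≟_ to _≟ᶠ_)
open import Data.List using (List; []; _∷_; map; _++_; allFin; length; tabulate; cartesianProduct)
open import Data.List.Properties using (map-++; map-cong; map-cong-local; map-∘; length-++)
open import Data.List.Relation.Unary.All using (All; []; _∷_) renaming (map to all-map)
open import Data.List.Relation.Unary.All.Properties using (++⁺)
open import Data.Nat.ListAction using (sum)
open import Data.Nat.ListAction.Properties using (sum-++)
open import Data.Product using (_,_; proj₁; proj₂)
open import Data.Sum using (_⊎_; inj₁; inj₂)
open import Function using (_∘_)
open import Relation.Nullary using (yes; no)
open import Relation.Nullary.Decidable using (toWitness; _×-dec_; _⊎-dec_)
open import Relation.Binary.PropositionalEquality
open import Data.Nat.Tactic.RingSolver using (solve-∀)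

rotate : ℕ → Fin 6 → Fin 6
rotate zero i = i
rotate (suc k) i = rotate k (next i)

hexDist-self : ∀ i → hexDist i i ≡ 0
hexDist-self = toWitness {a? = all? λ i → hexDist i i ≟ 0} _

hexDist-sym : ∀ i j → hexDist i j ≡ hexDist j i
hexDist-sym = toWitness {a? = all? λ i → all? λ j → hexDist i j ≟ hexDist j i} _

hexDist-geodesic : ∀ i j → rotate (hexDist i j) i ≡ j ⊎ rotate (hexDist i j) j ≡ i
hexDist-geodesic = toWitness {a? = all? λ i → all? λ j →
  (rotate (hexDist i j) i ≟ᶠ j) ⊎-dec (rotate (hexDist i j) j ≟ᶠ i)} _

Close : Fin 6 → Fin 6 → Set
Close i i' = ∀ y → hexDist i y ≤ suc (hexDist i' y)

hexDist-next : ∀ i → Close i (next i) × Close (next i) i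
hexDist-next i = (λ y → proj₁ (both i y)) , (λ y → proj₂ (both i y))
  where
  both : ∀ i y → hexDist i y ≤ suc (hexDist (next i) y) × hexDist (next i) y ≤ suc (hexDist i y)
  both = toWitness {a? = all? λ i → all? λ y →
    (hexDist i y ≤? suc (hexDist (next i) y)) ×-dec (hexDist (next i) y ≤? suc (hexDist i y))} _

close-sym : ∀ {i i'} → Close i i' → ∀ y → hexDist y i ≤ suc (hexDist y i')
close-sym {i} {i'} h y = subst₂ (λ a b → a ≤ suc b) (hexDist-sym i y) (hexDist-sym i' y) (h y)

hexagon-transmission : ∀ x → sum (map (hexDist x) (allFin 6)) ≡ 9
hexagon-transmission = toWitness {a? = all? λ x → sum (map (hexDist x) (allFin 6)) ≟ 9} _

hexagon-transmission-via-edge : ∀ y → sum (map (λ i → suc (hexDist i y)) (allFin 6)) ≡ 15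
hexagon-transmission-via-edge =
  toWitness {a? = all? λ y → sum (map (λ i → suc (hexDist i y)) (allFin 6)) ≟ 15} _

sum-map-shift : {A : Set} (a : ℕ) (F : A → ℕ) (L : List A) →
  sum (map (λ q → a + F q) L) ≡ length L * a + sum (map F L)
sum-map-shift a F [] = refl
sum-map-shift a F (x ∷ L) rewrite sum-map-shift a F L = regroup a (F x) (length L) (sum (map F L))
  where
  regroup : ∀ a b l s → a + b + (l * a + s) ≡ a + l * a + (b + s)
  regroup = solve-∀

sum-map-affine : {A : Set} (a X : ℕ) (f : A → ℕ) (L : List A) →
  sum (map (λ i → a * f i + X) L) ≡ a * sum (map f L) + length L * X
sum-map-affine a X f [] = sym (cong (_+ 0) (*-zeroʳ a))
sum-map-affine a X f (x ∷ L) rewrite sum-map-affine a X f L =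
  regroup a X (f x) (sum (map f L)) (length L)
  where
  regroup : ∀ a X b S l → a * b + X + (a * S + l * X) ≡ a * (b + S) + (X + l * X)
  regroup = solve-∀

pairs-map : {A B : Set} (f : A → B) (xs : List A) →
  pairs (map f xs) ≡ map (λ p → (f (proj₁ p) , f (proj₂ p))) (pairs xs)
pairs-map f [] = refl
pairs-map {A} {B} f (x ∷ xs) =
  trans (cong₂ _++_ head-row (pairs-map f xs)) (sym (map-++ f×f (map (x ,_) xs) (pairs xs)))
  where
  f×f : A × A → B × B
  f×f p = f (proj₁ p) , f (proj₂ p)
  head-row : map (f x ,_) (map f xs) ≡ map f×f (map (x ,_) xs)
  head-row = trans (sym (map-∘ {g = f x ,_} {f = f} xs)) (map-∘ {g = f×f} {f = x ,_} xs)

module PairSums {A : Set} (f : A × A → ℕ) where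

  pairSum : List A → ℕ
  pairSum L = sum (map f (pairs L))

  rowSum : A → List A → ℕ
  rowSum x L = sum (map (λ y → f (x , y)) L)

  crossSum : List A → List A → ℕ
  crossSum X Y = sum (map (λ x → rowSum x Y) X)

  pairSum-cons : ∀ x L → pairSum (x ∷ L) ≡ rowSum x L + pairSum L
  pairSum-cons x L = trans (cong sum (map-++ f (map (x ,_) L) (pairs L)))
    (trans (sum-++ (map f (map (x ,_) L)) (map f (pairs L)))
      (cong (_+ pairSum L) (cong sum (sym (map-∘ {g = f} {f = x ,_} L)))))

  rowSum-++ : ∀ x X Y → rowSum x (X ++ Y) ≡ rowSum x X + rowSum x Y
  rowSum-++ x X Y = trans (cong sum (map-++ (λ y → f (x , y)) X Y)) (sum-++ (map (λ y → f (x , y)) X) _)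

  pairSum-++ : ∀ X Y → pairSum (X ++ Y) ≡ pairSum X + crossSum X Y + pairSum Y
  pairSum-++ [] Y = refl
  pairSum-++ (x ∷ X) Y = begin
      pairSum (x ∷ (X ++ Y))
    ≡⟨ pairSum-cons x (X ++ Y) ⟩
      rowSum x (X ++ Y) + pairSum (X ++ Y)
    ≡⟨ cong₂ _+_ (rowSum-++ x X Y) (pairSum-++ X Y) ⟩
      (rowSum x X + rowSum x Y) + (pairSum X + crossSum X Y + pairSum Y)
    ≡⟨ regroup (rowSum x X) (rowSum x Y) (pairSum X) (crossSum X Y) (pairSum Y) ⟩
      (rowSum x X + pairSum X) + (rowSum x Y + crossSum X Y) + pairSum Y
    ≡⟨ cong (λ z → z + (rowSum x Y + crossSum X Y) + pairSum Y) (sym (pairSum-cons x X)) ⟩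
      pairSum (x ∷ X) + crossSum (x ∷ X) Y + pairSum Y
    ∎
    where
    open ≡-Reasoning
    regroup : ∀ a b c d e → (a + b) + (c + d + e) ≡ (a + c) + (b + d) + e
    regroup = solve-∀

hexagon : ℕ → List (ℕ × Fin 6)
hexagon b = map (b ,_) (allFin 6)

verts : ℕ → ℕ → List (ℕ × Fin 6)
verts b zero = []
verts b (suc m) = hexagon b ++ verts (suc b) m

length-verts : ∀ b m → length (verts b m) ≡ m * 6
length-verts b zero = refl
length-verts b (suc m) = trans (length-++ (hexagon b) {verts (suc b) m}) (cong (6 +_) (length-verts (suc b) m))

verts-above : ∀ m b → All (λ q → b ≤ proj₁ q) (verts b m)
verts-above zero b = []
verts-above (suc m) b = ++⁺ (≤-refl ∷ ≤-refl ∷ ≤-refl ∷ ≤-refl ∷ ≤-refl ∷ ≤-refl ∷ [])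
  (all-map (≤-trans (n≤1+n b)) (verts-above m (suc b)))

forgetFin : ∀ {n} → V n → ℕ × Fin 6
forgetFin (k , i) = toℕ k , i

-- The vertex list 'allV n' used by 'Wiener' is 'verts 0 n' once hexagon
-- indices are read as natural numbers.
verts-tabulate : ∀ {N} m (f : Fin m → Fin N) b → (∀ i → toℕ (f i) ≡ b + toℕ i) →
  map forgetFin (cartesianProduct (tabulate f) (allFin 6)) ≡ verts b m
verts-tabulate zero f b h = refl
verts-tabulate (suc m) f b h =
  trans (map-++ forgetFin (map (f fzero ,_) (allFin 6)) _)
   (cong₂ _++_ (cong (λ z → map (z ,_) (allFin 6)) (trans (h fzero) (+-identityʳ b)))
     (verts-tabulate m (f ∘ fsuc) (suc b) (λ i → trans (h (fsuc i)) (+-suc b (toℕ i)))))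

difference-from : ∀ {w a p r s} → w + a ≡ p → r + a ≡ p + s → w ≡ r ∸ s
difference-from {w} {a} {p} {r} {s} w+a≡p r+a≡p+s = begin
    w                ≡⟨ sym (m+n∸n≡m w s) ⟩
    w + s ∸ s        ≡⟨ cong (_∸ s) (+-cancelʳ-≡ a (w + s) r w+s+a≡r+a) ⟩
    r ∸ s            ∎
  where
  open ≡-Reasoning
  w+s+a≡r+a : w + s + a ≡ r + a
  w+s+a≡r+a = begin
    w + s + a        ≡⟨ +-assoc w s a ⟩
    w + (s + a)      ≡⟨ cong (w +_) (+-comm s a) ⟩
    w + (a + s)      ≡⟨ sym (+-assoc w a s) ⟩
    w + a + s        ≡⟨ cong (_+ s) w+a≡p ⟩
    p + s            ≡⟨ sym r+a≡p+s ⟩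
    r + a            ∎

-- Closed form of the Wiener index of a chain of m+1 hexagons with all gaps
-- equal to δ, written without subtraction (the coefficient of m is 93 - 6δ).
wienerClosed : ℕ → ℕ → ℕ
wienerClosed δ m = 6 * suc δ * (m * m * m) + 72 * (m * m) + 93 * m + 27

module Chain (c t : ℕ → Fin 6) where

  -- 'ascent k i g j': length of the path from vertex i of hexagon k to
  -- vertex j of hexagon k+g: to the exit t(k+1), over the cut-edge (the
  -- 'suc'), then onwards from c(k+1).
  ascent : ℕ → Fin 6 → ℕ → Fin 6 → ℕ
  ascent k i zero j = hexDist i j
  ascent k i (suc g) j = suc (hexDist i (t (suc k)) + ascent (suc k) (c (suc k)) g j)

  -- 'chainDist b k i l j': distance between vertex i of hexagon b+k and
  -- vertex j of hexagon b+l (an ascent from the lower of the two).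
  chainDist : ℕ → ℕ → Fin 6 → ℕ → Fin 6 → ℕ
  chainDist b zero i zero j = hexDist i j
  chainDist b zero i (suc l) j = ascent b i (suc l) j
  chainDist b (suc k) i zero j = ascent b j (suc k) i
  chainDist b (suc k) i (suc l) j = chainDist (suc b) k i l j

  dist : ∀ {n} → V n → V n → ℕ
  dist (k , i) (l , j) = chainDist 0 (toℕ k) i (toℕ l) j

  chainDist-zeroˡ : ∀ b x M y → chainDist b 0 x M y ≡ ascent b x M y
  chainDist-zeroˡ b x zero y = refl
  chainDist-zeroˡ b x (suc M) y = refl

  chainDist-zeroʳ : ∀ b L x y → chainDist b L x 0 y ≡ ascent b y L x
  chainDist-zeroʳ b zero x y = hexDist-sym x y
  chainDist-zeroʳ b (suc L) x y = refl

  chainDist-same : ∀ b k i j → chainDist b k i k j ≡ hexDist i j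
  chainDist-same b zero i j = refl
  chainDist-same b (suc k) i j = chainDist-same (suc b) k i j

  chainDist-up : ∀ b k i g j → chainDist b k i (k + g) j ≡ ascent (b + k) i g j
  chainDist-up b zero i g j = trans (chainDist-zeroˡ b i g j) (cong (λ z → ascent z i g j) (sym (+-identityʳ b)))
  chainDist-up b (suc k) i g j = trans (chainDist-up (suc b) k i g j) (cong (λ z → ascent z i g j) (sym (+-suc b k)))

  chainDist-down : ∀ b l i g j → chainDist b (l + g) i l j ≡ ascent (b + l) j g i
  chainDist-down b zero i g j = trans (chainDist-zeroʳ b g i j) (cong (λ z → ascent z j g i) (sym (+-identityʳ b)))
  chainDist-down b (suc l) i g j = trans (chainDist-down (suc b) l i g j) (cong (λ z → ascent z j g i) (sym (+-suc b l)))

  ascent-last : ∀ g b y z →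
    ascent b y (suc g) z ≡ suc (ascent b y g (t (b + suc g)) + hexDist (c (b + suc g)) z)
  ascent-last zero b y z rewrite +-suc b 0 | +-identityʳ b = refl
  ascent-last (suc g) b y z rewrite +-suc b (suc g) | ascent-last g (suc b) (c (suc b)) z =
    cong suc (trans (+-suc (hexDist y (t (suc b))) _) (cong suc (sym (+-assoc (hexDist y (t (suc b))) _ _))))

  adj-sym : ∀ {n u w} → Adj n c t u w → Adj n c t w u
  adj-sym (inj₁ (eq , inj₁ p)) = inj₁ (sym eq , inj₂ p)
  adj-sym (inj₁ (eq , inj₂ p)) = inj₁ (sym eq , inj₁ p)
  adj-sym (inj₂ (inj₁ x)) = inj₂ (inj₂ x)
  adj-sym (inj₂ (inj₂ x)) = inj₂ (inj₁ x)

  _++ʷ_ : ∀ {n u w v a b} → Walk n c t u w a → Walk n c t w v b → Walk n c t u v (a + b)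
  here ++ʷ q = q
  step x p ++ʷ q = step x (p ++ʷ q)

  _∷ʳʷ_ : ∀ {n u w v m} → Walk n c t u w m → Adj n c t w v → Walk n c t u v (suc m)
  here ∷ʳʷ a = step a here
  step b p ∷ʳʷ a = step b (p ∷ʳʷ a)

  reverseʷ : ∀ {n u v m} → Walk n c t u v m → Walk n c t v u m
  reverseʷ here = here
  reverseʷ (step a p) = reverseʷ p ∷ʳʷ adj-sym a

  rotateWalk : ∀ {n} (K : Fin n) k i → Walk n c t (K , i) (K , rotate k i) k
  rotateWalk K zero i = here
  rotateWalk K (suc k) i = step (inj₁ (refl , inj₁ refl)) (rotateWalk K k (next i))

  hexWalk : ∀ {n} (K : Fin n) i j → Walk n c t (K , i) (K , j) (hexDist i j)
  hexWalk {n} K i j with hexDist-geodesic i j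
  ... | inj₁ e = subst (λ z → Walk n c t (K , i) (K , z) (hexDist i j)) e (rotateWalk K (hexDist i j) i)
  ... | inj₂ e = subst (λ z → Walk n c t (K , z) (K , j) (hexDist i j)) e
                   (reverseʷ (rotateWalk K (hexDist i j) j))

  ascentWalk : ∀ {n} g (K L : Fin n) k i j → toℕ K ≡ k → toℕ L ≡ k + g →
    Walk n c t (K , i) (L , j) (ascent k i g j)
  ascentWalk zero K L k i j eK eL
    rewrite toℕ-injective {i = L} {j = K} (trans eL (trans (+-identityʳ k) (sym eK))) = hexWalk K i j
  ascentWalk {n} (suc g) K L k i j eK eL =
    subst (Walk n c t _ _) (+-suc (hexDist i (t (suc k))) _)
      (hexWalk K i (t (suc k)) ++ʷ step cut (ascentWalk g K' L (suc k) (c (suc k)) j eK' (trans eL (+-suc k g))))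
    where
    next-exists : suc k < n
    next-exists = ≤-trans (s≤s (s≤s (m≤m+n k g)))
      (≤-trans (≤-reflexive (cong suc (trans (sym (+-suc k g)) (sym eL)))) (toℕ<n L))
    K' : Fin n
    K' = fromℕ< next-exists
    eK' : toℕ K' ≡ suc k
    eK' = toℕ-fromℕ< next-exists
    cut : Adj n c t (K , t (suc k)) (K' , c (suc k))
    cut = inj₂ (inj₂ (trans eK' (cong suc (sym eK)) , cong c (sym eK') , cong t (sym eK')))

  distWalk : ∀ {n} (u v : V n) → Walk n c t u v (dist u v)
  distWalk {n} (K , i) (L , j) with toℕ K ≤? toℕ L
  ... | yes K≤L = subst (Walk n c t _ _) (sym (trans (cong (λ z → chainDist 0 (toℕ K) i z j) eL)
                    (chainDist-up 0 (toℕ K) i g j)))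
                    (ascentWalk g K L (toℕ K) i j refl eL)
    where
    g = toℕ L ∸ toℕ K
    eL : toℕ L ≡ toℕ K + g
    eL = sym (m+[n∸m]≡n K≤L)
  ... | no K≰L = subst (Walk n c t _ _) (sym (trans (cong (λ z → chainDist 0 z i (toℕ L) j) eK)
                   (chainDist-down 0 (toℕ L) i g j)))
                   (reverseʷ (ascentWalk g L K (toℕ L) j i refl eK))
    where
    g = toℕ K ∸ toℕ L
    eK : toℕ K ≡ toℕ L + g
    eK = sym (m+[n∸m]≡n (<⇒≤ (≰⇒> K≰L)))

  -- Lower bound: 'dist' changes by at most one along every edge.

  ascent-closeˡ : ∀ k i i' g j → Close i i' → ascent k i g j ≤ suc (ascent k i' g j)
  ascent-closeˡ k i i' zero j h = h j
  ascent-closeˡ k i i' (suc g) j h = s≤s (+-monoˡ-≤ (ascent (suc k) (c (suc k)) g j) (h (t (suc k))))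

  ascent-closeʳ : ∀ k x g j j' → Close j j' → ascent k x g j ≤ suc (ascent k x g j')
  ascent-closeʳ k x zero j j' h = close-sym h x
  ascent-closeʳ k x (suc g) j j' h =
    s≤s (≤-trans (+-monoʳ-≤ (hexDist x (t (suc k))) (ascent-closeʳ (suc k) (c (suc k)) g j j' h))
                 (≤-reflexive (+-suc _ _)))

  chainDist-close : ∀ b K i i' L j → Close i i' → chainDist b K i L j ≤ suc (chainDist b K i' L j)
  chainDist-close b zero i i' zero j h = h j
  chainDist-close b zero i i' (suc L) j h = ascent-closeˡ b i i' (suc L) j h
  chainDist-close b (suc K) i i' zero j h = ascent-closeʳ b j (suc K) i i' h
  chainDist-close b (suc K) i i' (suc L) j h = chainDist-close (suc b) K i i' L j h

  chainDist-cut : ∀ b L a → a ≡ b + suc L → ∀ M y →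
    chainDist b (suc L) (c a) M y ≡ suc (chainDist b L (t a) M y)
    ⊎ chainDist b L (t a) M y ≡ suc (chainDist b (suc L) (c a) M y)
  chainDist-cut b L a refl zero y
    rewrite chainDist-zeroʳ b L (t (b + suc L)) y | ascent-last L b y (c (b + suc L)) | hexDist-self (c (b + suc L)) =
    inj₁ (cong suc (+-identityʳ _))
  chainDist-cut b zero a refl (suc M) y
    rewrite +-suc b 0 | +-identityʳ b | chainDist-zeroˡ (suc b) (c (suc b)) M y | hexDist-self (t (suc b)) =
    inj₂ refl
  chainDist-cut b (suc L) a eq (suc M) y = chainDist-cut (suc b) L a (trans eq (+-suc b (suc L))) M y

  off-by-one : ∀ {x y} → x ≡ suc y ⊎ y ≡ suc x → x ≤ suc y × y ≤ suc x
  off-by-one {y = y} (inj₁ refl) = ≤-refl , m≤n⇒m≤1+n (n≤1+n y)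
  off-by-one {x} (inj₂ refl) = m≤n⇒m≤1+n (n≤1+n x) , ≤-refl

  dist-adjacent : ∀ {n} (u w : V n) → Adj n c t u w → ∀ v → dist u v ≤ suc (dist w v)
  dist-adjacent (k , i) (l , j) (inj₁ (refl , inj₁ refl)) (m , y) =
    chainDist-close 0 (toℕ k) i (next i) (toℕ m) y (proj₁ (hexDist-next i))
  dist-adjacent (k , i) (l , j) (inj₁ (refl , inj₂ refl)) (m , y) =
    chainDist-close 0 (toℕ k) (next j) j (toℕ m) y (proj₂ (hexDist-next j))
  dist-adjacent (k , i) (l , j) (inj₂ (inj₁ (eq , refl , refl))) (m , y) rewrite eq =
    proj₁ (off-by-one (chainDist-cut 0 (toℕ l) (suc (toℕ l)) refl (toℕ m) y))
  dist-adjacent (k , i) (l , j) (inj₂ (inj₂ (eq , refl , refl))) (m , y) rewrite eq =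
    proj₂ (off-by-one (chainDist-cut 0 (toℕ k) (suc (toℕ k)) refl (toℕ m) y))

  dist-≤-walk : ∀ {n u v m} → Walk n c t u v m → dist u v ≤ m
  dist-≤-walk {u = k , i} here = ≤-reflexive (trans (chainDist-same 0 (toℕ k) i i) (hexDist-self i))
  dist-≤-walk (step {u} {w} {v} a p) = ≤-trans (dist-adjacent u w a v) (s≤s (dist-≤-walk p))

  dist-isShortest : ∀ n → IsShortestPathDist n c t dist
  dist-isShortest n u v = distWalk u v , λ m w → dist-≤-walk w

  pairDist : (ℕ × Fin 6) × (ℕ × Fin 6) → ℕ
  pairDist ((k , i) , (l , j)) = chainDist 0 k i l j

  open PairSums pairDist

  transmission : ℕ → Fin 6 → ℕ → ℕ
  transmission b x m = rowSum (b , x) (verts b m)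

  subWiener : ℕ → ℕ → ℕ
  subWiener b m = pairSum (verts b m)

  wiener-as-subWiener : ∀ n → Wiener n dist ≡ subWiener 0 n
  wiener-as-subWiener n = cong sum (trans (map-∘ (pairs (allV n)))
    (cong (map pairDist) (trans (sym (pairs-map forgetFin (allV n)))
      (cong pairs (verts-tabulate n (λ i → i) 0 (λ i → refl))))))

  dist-via-cut : ∀ b x l j → b < l →
    chainDist 0 b x l j ≡ suc (hexDist x (t (suc b))) + chainDist 0 (suc b) (c (suc b)) l j
  dist-via-cut b x l j b<l = begin
      chainDist 0 b x l j
    ≡⟨ cong (λ z → chainDist 0 b x z j) (trans l≡ (sym (+-suc b g))) ⟩
      chainDist 0 b x (b + suc g) j
    ≡⟨ chainDist-up 0 b x (suc g) j ⟩
      suc (hexDist x (t (suc b)) + ascent (suc b) (c (suc b)) g j)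
    ≡⟨ cong (λ z → suc (hexDist x (t (suc b)) + z))
         (sym (trans (cong (λ z → chainDist 0 (suc b) (c (suc b)) z j) l≡) (chainDist-up 0 (suc b) (c (suc b)) g j))) ⟩
      suc (hexDist x (t (suc b))) + chainDist 0 (suc b) (c (suc b)) l j
    ∎
    where
    open ≡-Reasoning
    g = l ∸ suc b
    l≡ : l ≡ suc b + g
    l≡ = sym (m+[n∸m]≡n b<l)

  rowSum-via-cut : ∀ m b' b x → b < b' →
    rowSum (b , x) (verts b' m) ≡ m * 6 * suc (hexDist x (t (suc b))) + rowSum (suc b , c (suc b)) (verts b' m)
  rowSum-via-cut m b' b x b<b' =
    trans (cong sum (map-cong-local (all-map (λ {q} p → dist-via-cut b x (proj₁ q) (proj₂ q) (≤-trans b<b' p))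
                                              (verts-above m b'))))
      (trans (sum-map-shift (suc (hexDist x (t (suc b)))) (λ q → pairDist ((suc b , c (suc b)) , q)) (verts b' m))
        (cong (λ z → z * suc (hexDist x (t (suc b))) + rowSum (suc b , c (suc b)) (verts b' m)) (length-verts b' m)))

  transmission-suc : ∀ b x m → transmission b x (suc m)
    ≡ 9 + (m * 6 * suc (hexDist x (t (suc b))) + transmission (suc b) (c (suc b)) m)
  transmission-suc b x m = trans (rowSum-++ (b , x) (hexagon b) (verts (suc b) m))
    (cong₂ _+_ (trans (cong sum (map-cong (λ j → chainDist-same 0 b x j) (allFin 6))) (hexagon-transmission x))
               (rowSum-via-cut m (suc b) b x ≤-refl))

  crossSum-first : ∀ b m →
    crossSum (hexagon b) (verts (suc b) m) ≡ m * 6 * 15 + 6 * transmission (suc b) (c (suc b)) m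
  crossSum-first b m = trans (cong sum (map-cong (λ i → rowSum-via-cut m (suc b) b i ≤-refl) (allFin 6)))
    (trans (sum-map-affine (m * 6) (transmission (suc b) (c (suc b)) m) (λ i → suc (hexDist i (t (suc b)))) (allFin 6))
      (cong (λ z → m * 6 * z + 6 * transmission (suc b) (c (suc b)) m) (hexagon-transmission-via-edge (t (suc b)))))

  subWiener-suc : ∀ b m → subWiener b (suc m)
    ≡ 27 + (m * 6 * 15 + 6 * transmission (suc b) (c (suc b)) m) + subWiener (suc b) m
  subWiener-suc b m = trans (pairSum-++ (hexagon b) (verts (suc b) m))
    (cong₂ (λ p q → p + q + subWiener (suc b) m) hexagon-pairs (crossSum-first b m))
    where
    hexagon-pairs : pairSum (hexagon b) ≡ 27
    hexagon-pairs = trans (cong (sum ∘ map pairDist) (pairs-map (b ,_) (allFin 6)))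
      (trans (cong sum (sym (map-∘ {g = pairDist} {f = λ p → ((b , proj₁ p) , (b , proj₂ p))} (pairs (allFin 6)))))
        (cong sum (map-cong (λ p → chainDist-same 0 b (proj₁ p) (proj₂ p)) (pairs (allFin 6)))))

  UniformGaps : ℕ → ℕ → ℕ → Set
  UniformGaps δ b m = ∀ r → suc r < m → hexDist (c (b + r)) (t (suc (b + r))) ≡ δ

  uniformGaps-tail : ∀ {δ b m} → UniformGaps δ b (suc m) → UniformGaps δ (suc b) m
  uniformGaps-tail {δ} {b} h r lt = subst (λ z → hexDist (c z) (t (suc z)) ≡ δ) (+-suc b r) (h (suc r) (s≤s lt))

  uniformGaps-head : ∀ {δ b m} → UniformGaps δ b (suc (suc m)) → hexDist (c b) (t (suc b)) ≡ δ
  uniformGaps-head {δ} {b} h = subst (λ z → hexDist (c z) (t (suc z)) ≡ δ) (+-identityʳ b) (h 0 (s≤s (s≤s z≤n)))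

  transmission-closed : ∀ δ m b → UniformGaps δ b (suc m) →
    transmission b (c b) (suc m) ≡ 9 * suc m + 3 * suc δ * (m * suc m)
  transmission-closed δ zero b h = trans (transmission-suc b (c b) 0) (base δ)
    where
    base : ∀ δ → 9 + 0 ≡ 9 * 1 + 3 * suc δ * 0
    base = solve-∀
  transmission-closed δ (suc m) b h = begin
      transmission b (c b) (suc (suc m))
    ≡⟨ transmission-suc b (c b) (suc m) ⟩
      9 + (suc m * 6 * suc (hexDist (c b) (t (suc b))) + transmission (suc b) (c (suc b)) (suc m))
    ≡⟨ cong₂ (λ p q → 9 + (suc m * 6 * suc p + q)) (uniformGaps-head h)
         (transmission-closed δ m (suc b) (uniformGaps-tail h)) ⟩
      9 + (suc m * 6 * suc δ + (9 * suc m + 3 * suc δ * (m * suc m)))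
    ≡⟨ arith δ m ⟩
      9 * suc (suc m) + 3 * suc δ * (suc m * suc (suc m))
    ∎
    where
    open ≡-Reasoning
    arith : ∀ δ m → 9 + (suc m * 6 * suc δ + (9 * suc m + 3 * suc δ * (m * suc m)))
                   ≡ 9 * suc (suc m) + 3 * suc δ * (suc m * suc (suc m))
    arith = solve-∀

  subWiener-closed : ∀ δ m b → UniformGaps δ (suc b) m →
    subWiener b (suc m) + 6 * δ * m ≡ wienerClosed δ m
  subWiener-closed δ zero b h = trans (cong (_+ 6 * δ * 0) (subWiener-suc b 0)) (base δ)
    where
    base : ∀ δ → 27 + (0 + 6 * 0) + 0 + 6 * δ * 0 ≡ 6 * suc δ * (0 * 0 * 0) + 72 * (0 * 0) + 93 * 0 + 27
    base = solve-∀
  subWiener-closed δ (suc m) b h = begin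
      subWiener b (suc (suc m)) + 6 * δ * suc m
    ≡⟨ cong (_+ 6 * δ * suc m) (subWiener-suc b (suc m)) ⟩
      27 + (suc m * 6 * 15 + 6 * transmission (suc b) (c (suc b)) (suc m)) + W + 6 * δ * suc m
    ≡⟨ cong (λ T → 27 + (suc m * 6 * 15 + 6 * T) + W + 6 * δ * suc m) (transmission-closed δ m (suc b) h) ⟩
      27 + (suc m * 6 * 15 + 6 * T) + W + 6 * δ * suc m
    ≡⟨ regroup (27 + (suc m * 6 * 15 + 6 * T)) W (6 * δ) m ⟩
      27 + (suc m * 6 * 15 + 6 * T) + 6 * δ + (W + 6 * δ * m)
    ≡⟨ cong (27 + (suc m * 6 * 15 + 6 * T) + 6 * δ +_) (subWiener-closed δ m (suc b) (uniformGaps-tail h)) ⟩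
      27 + (suc m * 6 * 15 + 6 * T) + 6 * δ + wienerClosed δ m
    ≡⟨ arith δ m ⟩
      wienerClosed δ (suc m)
    ∎
    where
    open ≡-Reasoning
    T = 9 * suc m + 3 * suc δ * (m * suc m)
    W = subWiener (suc b) (suc m)
    regroup : ∀ a w d m → a + w + d * suc m ≡ a + d + (w + d * m)
    regroup = solve-∀
    arith : ∀ δ m → 27 + (suc m * 6 * 15 + 6 * (9 * suc m + 3 * suc δ * (m * suc m))) + 6 * δ
                      + (6 * suc δ * (m * m * m) + 72 * (m * m) + 93 * m + 27)
                    ≡ 6 * suc δ * (suc m * suc m * suc m) + 72 * (suc m * suc m) + 93 * suc m + 27
    arith = solve-∀

uniformChain-wiener : ∀ δ m (c t : ℕ → Fin 6) → IsChainType (suc m) δ c t →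
  Wiener (suc m) (Chain.dist c t) + 6 * δ * m ≡ wienerClosed δ m
uniformChain-wiener δ m c t chain =
  trans (cong (_+ 6 * δ * m) (wiener-as-subWiener (suc m)))
        (subWiener-closed δ m 0 (λ r lt → chain (suc (suc r)) (s≤s (s≤s z≤n)) (s≤s lt)))
  where open Chain c t

uniformChain-hasWiener : ∀ δ m (c t : ℕ → Fin 6) (r s : ℕ) →
  r + 6 * δ * m ≡ wienerClosed δ m + s →
  IsChainType (suc m) δ c t → HasWiener (suc m) c t (r ∸ s)
uniformChain-hasWiener δ m c t r s matches chain =
  Chain.dist c t , Chain.dist-isShortest c t (suc m) , difference-from (uniformChain-wiener δ m c t chain) matches

corollary3p3 : (n : ℕ) → 1 ≤ n → (c t : ℕ → Fin 6) →
    (IsChainType n 1 c t → HasWiener n c t (12 * n ^ 3 + 36 * n ^ 2 ∸ 21 * n))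
    × (IsChainType n 2 c t → HasWiener n c t (18 * n ^ 3 + 18 * n ^ 2 ∸ 9 * n))
    × (IsChainType n 3 c t → HasWiener n c t (24 * n ^ 3 + 3 * n))
corollary3p3 (suc m) _ c t =
    uniformChain-hasWiener 1 m c t _ (21 * suc m) (ortho m)
  , uniformChain-hasWiener 2 m c t _ (9 * suc m) (meta m)
  , uniformChain-hasWiener 3 m c t _ 0 (para m)
  where
  -- n ^ k unfolds to n * (n * … * 1), the form the ring solver accepts
  ortho : ∀ m → 12 * (suc m * (suc m * (suc m * 1))) + 36 * (suc m * (suc m * 1)) + 6 * 1 * m
                ≡ 6 * 2 * (m * m * m) + 72 * (m * m) + 93 * m + 27 + 21 * suc m
  ortho = solve-∀
  meta : ∀ m → 18 * (suc m * (suc m * (suc m * 1))) + 18 * (suc m * (suc m * 1)) + 6 * 2 * m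
               ≡ 6 * 3 * (m * m * m) + 72 * (m * m) + 93 * m + 27 + 9 * suc m
  meta = solve-∀
  para : ∀ m → 24 * (suc m * (suc m * (suc m * 1))) + 3 * suc m + 6 * 3 * m
               ≡ 6 * 4 * (m * m * m) + 72 * (m * m) + 93 * m + 27 + 0
  para = solve-∀
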